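{- Let $G$ be a finite connected graph, $R$ a USP-relation on $E(G)$, and $Q\subseteq R$ an equivalence relation on $E(G)$ with the unique square property. Let $[v,w]\in\chi$ for a $Q$-class $\chi$, and let $\varphi$ be an $R$-class with $\varphi\cap\chi=\emptyset$. Let $H$ be the subgraph of $G$ with vertex set $V(G_\varphi^v)\cup V(G_\varphi^w)$ and edge set $$E(H)=\{[x,y]\in\varphi\mid x,y\in V(G_\varphi^v)\cup V(G_\varphi^w)\}\cup\{[x,y]\in\chi\mid x,y\in V(G_\varphi^v)\cup V(G_\varphi^w)\}.$$ Then the restriction of $Q$ to $E(H)$ has the unique square property on $H$.
   Context: For $\varphi\subseteq E(G)$, $G_\varphi$ is the spanning subgraph with edge set $\varphi$ and $G_\varphi^x$ its connected component containing $x$. A chordless square is an induced 4-cycle. An equivalence relation $Q$ on the edge set of a graph has the unique square property if any two adjacent edges in distinct $Q$-classes are contained in exactly one chordless square (of that graph) whose opposite edges lie in the same $Q$-class. An equivalence relation $R$ on $E(G)$ is a USP-relation if some equivalence relation $Q\subseteq R$ has the unique square property. -}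

module Defs where

open import Data.Nat using (ℕ)
open import Data.Fin using (Fin)
open import Data.Product using (Σ; ∃; ∃!; _×_; _,_)
open import Data.Sum using (_⊎_)
open import Relation.Nullary using (¬_)
open import Relation.Binary.PropositionalEquality using (_≡_)

-- A (finite) graph on vertex set Fin n is given by an adjacency relation.
-- An "edge predicate" E : Fin n → Fin n → Set describes a set of edges:
-- E x y means [x,y] is an edge.
VPred : ℕ → Set₁
VPred n = Fin n → Set

EPred : ℕ → Set₁
EPred n = Fin n → Fin n → Set

record IsSimpleGraph {n : ℕ} (Adj : EPred n) : Set where
  field
    adj-sym    : ∀ {x y} → Adj x y → Adj y x
    adj-irrefl : ∀ {x} → ¬ Adj x x

-- Reach E x y : y lies in the connected component of x in the spanning
-- subgraph with edge set E (i.e. there is a walk from x to y using E-edges).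
data Reach {n : ℕ} (E : EPred n) : Fin n → Fin n → Set where
  here : ∀ {x} → Reach E x x
  step : ∀ {x y z} → E x y → Reach E y z → Reach E x z

Connected : {n : ℕ} → EPred n → Set
Connected {n} Adj = ∀ (x y : Fin n) → Reach Adj x y

-- A binary relation on edges: Rel x y x' y' means [x,y] ~ [x',y'].
ERel : ℕ → Set₁
ERel n = Fin n → Fin n → Fin n → Fin n → Set

-- Equivalence relation on the edge set E (edges unordered: [x,y] = [y,x]).
record IsEdgeEquiv {n : ℕ} (E : EPred n) (Q : ERel n) : Set where
  field
    support  : ∀ {x y x' y'} → Q x y x' y' → E x y × E x' y'
    e-refl   : ∀ {x y} → E x y → Q x y x y
    e-flip   : ∀ {x y x' y'} → Q x y x' y' → Q y x x' y'
    e-sym    : ∀ {x y x' y'} → Q x y x' y' → Q x' y' x y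
    e-trans  : ∀ {x y x' y' x'' y''} → Q x y x' y' → Q x' y' x'' y'' → Q x y x'' y''

_⊆ᴱ_ : {n : ℕ} → ERel n → ERel n → Set
_⊆ᴱ_ {n} Q R = ∀ {x y x' y' : Fin n} → Q x y x' y' → R x y x' y'

record ChordlessSquare {n : ℕ} (E : EPred n) (x y w z : Fin n) : Set where
  field
    xy : E x y
    yw : E y w
    wz : E w z
    zx : E z x
    x≢y : ¬ x ≡ y
    x≢w : ¬ x ≡ w
    x≢z : ¬ x ≡ z
    y≢w : ¬ y ≡ w
    y≢z : ¬ y ≡ z
    w≢z : ¬ w ≡ z
    no-chord-xw : ¬ E x w
    no-chord-yz : ¬ E y z

GoodSquare : {n : ℕ} → EPred n → ERel n → Fin n → Fin n → Fin n → Fin n → Set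
GoodSquare E Q x y z w = ChordlessSquare E x y w z × Q x y w z × Q x z y w

-- Unique square property of Q on the graph with edge set E: any two adjacent
-- edges [x,y], [x,z] in distinct Q-classes lie in exactly one chordless square
-- whose opposite edges are Q-related.  (Two edges sharing a vertex in a
-- 4-cycle are consecutive, so such a square is determined by its fourth vertex.)
USP : {n : ℕ} → EPred n → ERel n → Set
USP {n} E Q = ∀ (x y z : Fin n) → E x y → E x z → ¬ Q x y x z →
  ∃! _≡_ (λ w → GoodSquare E Q x y z w)

USPRelation : {n : ℕ} → EPred n → ERel n → Set₁
USPRelation {n} E R = Σ (ERel n) λ Q' → IsEdgeEquiv E Q' × (Q' ⊆ᴱ R) × USP E Q'

-- Vertex set of H: V(G_φ^v) ∪ V(G_φ^w), φ given as an edge predicate.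
HVert : {n : ℕ} → EPred n → Fin n → Fin n → VPred n
HVert φ v w x = Reach φ v x ⊎ Reach φ w x

HEdge : {n : ℕ} → EPred n → EPred n → Fin n → Fin n → EPred n
HEdge φ χ v w x y = HVert φ v w x × HVert φ v w y × (φ x y ⊎ χ x y)

Restrict : {n : ℕ} → EPred n → ERel n → ERel n
Restrict E Q x y x' y' = E x y × E x' y' × Q x y x' y'

module Submission where

-- The unique square property passes to a subgraph H ⊆ G as soon as H is
-- "square-closed": whenever two adjacent H-edges lie in distinct Q-classes, the
-- two remaining edges of their (unique) good square in G belong to H again.
-- Indeed, the good square of G is then a good square of H, and conversely every
-- good square of H is a good square of G: its edges are G-edges, and a chord in
-- G would create a triangle with two edges in distinct Q-classes, which the
-- unique square property of G forbids.  Hence existence and uniqueness in H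
-- are inherited from G.

open import Defs
open import Data.Nat using (ℕ)
open import Data.Fin using (Fin)
open import Data.Product using (_×_; _,_; proj₁; proj₂)
open import Data.Sum using (inj₁; inj₂)
open import Data.Empty using (⊥; ⊥-elim)
open import Relation.Nullary using (¬_)
open import Relation.Binary.PropositionalEquality using (_≡_)

reach-snoc : ∀ {n} {E : EPred n} {v x y} → Reach E v x → E x y → Reach E v y
reach-snoc here e = step e here
reach-snoc (step e r) e' = step e (reach-snoc r e')

hvert-snoc : ∀ {n} {φ : EPred n} {v w x y} → HVert φ v w x → φ x y → HVert φ v w y
hvert-snoc (inj₁ r) e = inj₁ (reach-snoc r e)
hvert-snoc (inj₂ r) e = inj₂ (reach-snoc r e)

flip₂ : ∀ {n} {E : EPred n} {Q : ERel n} → IsEdgeEquiv E Q →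
  ∀ {x y x' y'} → Q x y x' y' → Q x y y' x'
flip₂ eQ q = e-sym (e-flip (e-sym q))
  where open IsEdgeEquiv eQ

SquareClosed : ∀ {n} → EPred n → ERel n → EPred n → Set
SquareClosed {n} Adj Q H = ∀ {x y z u : Fin n} → H x y → H x z → ¬ Q x y x z →
  GoodSquare Adj Q x y z u → H y u × H u z

module Transfer {n : ℕ} {Adj : EPred n} (sg : IsSimpleGraph Adj)
  {Q : ERel n} (eQ : IsEdgeEquiv Adj Q) (usp : USP Adj Q) where

  open IsSimpleGraph sg
  open IsEdgeEquiv eQ

  -- Under the unique square property, two adjacent edges in distinct Q-classes
  -- never lie in a triangle: the third edge would be a chord of their square.
  no-triangle : ∀ {x y z} → Adj x y → Adj x z → Adj y z → ¬ Q x y x z → ⊥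
  no-triangle {x} {y} {z} xy xz yz nq =
    ChordlessSquare.no-chord-yz (proj₁ (proj₁ (proj₂ (usp x y z xy xz nq)))) yz

  module _ {H : EPred n} (H⊆Adj : ∀ {x y} → H x y → Adj x y) where

    -- A chord [x,u] would close triangles x-y-u and x-z-u; both triangles being
    -- impossible forces [x,y] Q [x,u] Q [x,z], contradicting the hypothesis.
    good-in-G : ∀ {x y z u} → ¬ Q x y x z →
      GoodSquare H (Restrict H Q) x y z u → GoodSquare Adj Q x y z u
    good-in-G {x} {y} {z} {u} nq (cs , (_ , _ , q₁) , (_ , _ , q₂)) =
      record
        { xy = H⊆Adj xy ; yw = H⊆Adj yw ; wz = H⊆Adj wz ; zx = H⊆Adj zx
        ; x≢y = x≢y ; x≢w = x≢w ; x≢z = x≢z ; y≢w = y≢w ; y≢z = y≢z ; w≢z = w≢z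
        ; no-chord-xw = chord-xu
        ; no-chord-yz = λ yz → no-triangle (H⊆Adj xy) (adj-sym (H⊆Adj zx)) yz nq
        } , q₁ , q₂
      where
      open ChordlessSquare cs
      chord-xu : ¬ Adj x u
      chord-xu xu =
        no-triangle (H⊆Adj xy) xu (H⊆Adj yw) λ xy~xu →
        no-triangle (adj-sym (H⊆Adj zx)) xu (adj-sym (H⊆Adj wz)) λ xz~xu →
        nq (e-trans xy~xu (e-sym xz~xu))

    good-in-H : (∀ {x y} → H x y → H y x) → SquareClosed Adj Q H →
      ∀ {x y z u} → (hxy : H x y) (hxz : H x z) → ¬ Q x y x z →
      GoodSquare Adj Q x y z u → GoodSquare H (Restrict H Q) x y z u
    good-in-H H-sym closed {x} {y} {z} {u} hxy hxz nq sq@(cs , q₁ , q₂) =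
      record
        { xy = hxy ; yw = hyu ; wz = huz ; zx = H-sym hxz
        ; x≢y = x≢y ; x≢w = x≢w ; x≢z = x≢z ; y≢w = y≢w ; y≢z = y≢z ; w≢z = w≢z
        ; no-chord-xw = λ h → no-chord-xw (H⊆Adj h)
        ; no-chord-yz = λ h → no-chord-yz (H⊆Adj h)
        } , (hxy , huz , q₁) , (hxz , hyu , q₂)
      where
      open ChordlessSquare cs
      hyu : H y u
      hyu = proj₁ (closed hxy hxz nq sq)
      huz : H u z
      huz = proj₂ (closed hxy hxz nq sq)

    usp-restrict : (∀ {x y} → H x y → H y x) → SquareClosed Adj Q H →
      USP H (Restrict H Q)
    usp-restrict H-sym closed x y z hxy hxz nQ' =
      u , good-in-H H-sym closed hxy hxz nq sq , λ sq' → unique (good-in-G nq sq')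
      where
      nq : ¬ Q x y x z
      nq q = nQ' (hxy , hxz , q)
      u : Fin n
      u = proj₁ (usp x y z (H⊆Adj hxy) (H⊆Adj hxz) nq)
      sq : GoodSquare Adj Q x y z u
      sq = proj₁ (proj₂ (usp x y z (H⊆Adj hxy) (H⊆Adj hxz) nq))
      unique : ∀ {u'} → GoodSquare Adj Q x y z u' → u ≡ u'
      unique = proj₂ (proj₂ (usp x y z (H⊆Adj hxy) (H⊆Adj hxz) nq))

module SubgraphH {n : ℕ} {Adj : EPred n} {R Q : ERel n}
  (eR : IsEdgeEquiv Adj R) (eQ : IsEdgeEquiv Adj Q) (Q⊆R : Q ⊆ᴱ R)
  (v w a b : Fin n) where

  module ER = IsEdgeEquiv eR
  module EQ = IsEdgeEquiv eQ

  -- The graph H of the theorem, with φ the R-class of [a,b] and χ the Q-class of [v,w].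
  H : EPred n
  H = HEdge (R a b) (Q v w) v w

  H⊆Adj : ∀ {x y} → H x y → Adj x y
  H⊆Adj (_ , _ , inj₁ r) = proj₂ (ER.support r)
  H⊆Adj (_ , _ , inj₂ q) = proj₂ (EQ.support q)

  H-sym : ∀ {x y} → H x y → H y x
  H-sym (hx , hy , inj₁ r) = hy , hx , inj₁ (flip₂ eR r)
  H-sym (hx , hy , inj₂ q) = hy , hx , inj₂ (flip₂ eQ q)

  -- The case analysis on whether [x,y] and [x,z] lie in φ or in χ; they cannot
  -- both lie in χ, since then they would be Q-related.
  H-squareClosed : SquareClosed Adj Q H
  H-squareClosed {y = y} {u = u} (_ , hy , inj₁ r₁) (_ , hz , inj₁ r₂) _ (_ , q₁ , q₂) =
    (hy , hu , inj₁ ryu) , (hu , hz , inj₁ (ER.e-trans r₁ (Q⊆R q₁)))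
    where
    ryu : R a b y u
    ryu = ER.e-trans r₂ (Q⊆R q₂)
    hu : HVert (R a b) v w u
    hu = hvert-snoc hy ryu
  H-squareClosed {z = z} {u = u} (_ , hy , inj₁ r₁) (_ , hz , inj₂ c₂) _ (_ , q₁ , q₂) =
    (hy , hu , inj₂ (EQ.e-trans c₂ q₂)) , (hu , hz , inj₁ ruz)
    where
    ruz : R a b u z
    ruz = ER.e-trans r₁ (Q⊆R q₁)
    hu : HVert (R a b) v w u
    hu = hvert-snoc hz (flip₂ eR ruz)
  H-squareClosed {y = y} {u = u} (_ , hy , inj₂ c₁) (_ , hz , inj₁ r₂) _ (_ , q₁ , q₂) =
    (hy , hu , inj₁ ryu) , (hu , hz , inj₂ (EQ.e-trans c₁ q₁))
    where
    ryu : R a b y u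
    ryu = ER.e-trans r₂ (Q⊆R q₂)
    hu : HVert (R a b) v w u
    hu = hvert-snoc hy ryu
  H-squareClosed (_ , _ , inj₂ c₁) (_ , _ , inj₂ c₂) nq _ =
    ⊥-elim (nq (EQ.e-trans (EQ.e-sym c₁) c₂))

-- Theorem: the restriction of Q to E(H) has the unique square property on H.
mainTheorem7 : (n : ℕ) (Adj : Fin n → Fin n → Set) → IsSimpleGraph Adj → Connected Adj →
    (R Q : ERel n) → IsEdgeEquiv Adj R → USPRelation Adj R →
    IsEdgeEquiv Adj Q → Q ⊆ᴱ R → USP Adj Q →
    (v w : Fin n) → Adj v w →
    (a b : Fin n) → Adj a b →
    (∀ x y → ¬ (R a b x y × Q v w x y)) →
    USP (HEdge (R a b) (Q v w) v w) (Restrict (HEdge (R a b) (Q v w) v w) Q)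
mainTheorem7 n Adj sg _ R Q eR _ eQ Q⊆R usp v w _ a b _ _ =
  Transfer.usp-restrict sg eQ usp H⊆Adj H-sym H-squareClosed
  where open SubgraphH eR eQ Q⊆R v w a b
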